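{- Let $G$ be a graph with $n$ vertices and fix $t,s>0$. If $G$ is not $(\frac{4n^2}{st},t)$-separable, then $G$ has a subgraph $H$ such that $|H|\ge t$ and $H$ has no separator of size at most $\frac{1}{s}|H|$.
   Context: For a graph $G=(V,E)$ on $n$ vertices, a set $S\subseteq V$ is a separator if there is a partition $V=A\cup B\cup S$ such that $G$ has no edges between $A$ and $B$ and $|A|,|B|\le 2n/3$. For positive reals $s,t$, a graph $G$ is $(s,t)$-separable if there is $S\subseteq V(G)$ with $|S|\le s$ such that every connected component of $G-S$ has at most $t$ vertices. $|H|$ denotes the number of vertices of $H$.
   Formalization: The parameters s and t range over the positive rationals instead of the positive reals. -}

module Defs where

open import Data.Nat as ℕ using (ℕ; _*_)
open import Data.Bool using (Bool; true)
open import Data.Fin using (Fin)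
open import Data.Fin.Subset using (Subset; _∈_; _∉_; ∣_∣)
open import Data.Integer using (+_)
open import Data.Rational using (ℚ; _/_; 0ℚ; _<_; >-nonZero; 1/_) renaming (_≤_ to _≤ℚ_; _*_ to _*ℚ_)
open import Data.Product using (Σ; ∃; _×_; _,_)
open import Data.Sum using (_⊎_)
open import Function using (_⇔_)
open import Function.Definitions using (Injective)
open import Relation.Binary.PropositionalEquality using (_≡_)
open import Relation.Nullary using (¬_)

record Graph : Set where
  field
    n      : ℕ
    adj    : Fin n → Fin n → Bool
    sym    : ∀ u v → adj u v ≡ adj v u
    irrefl : ∀ v → ¬ (adj v v ≡ true)
open Graph public

⟦_⟧ : ℕ → ℚ
⟦ k ⟧ = + k / 1

data Reach (G : Graph) (S : Subset (n G)) (v : Fin (n G)) : Fin (n G) → Set where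
  here : v ∉ S → Reach G S v v
  step : ∀ {u w} → Reach G S v u → adj G u w ≡ true → w ∉ S → Reach G S v w

-- every connected component of G - S has at most t vertices
-- (the component of v ∉ S is the subset C of vertices reachable from v in G - S)
ComponentsAtMost : (G : Graph) → Subset (n G) → ℚ → Set
ComponentsAtMost G S t =
  ∀ (v : Fin (n G)) → v ∉ S → ∀ (C : Subset (n G)) →
  (∀ u → (u ∈ C) ⇔ Reach G S v u) → ⟦ ∣ C ∣ ⟧ ≤ℚ t

Separable : Graph → ℚ → ℚ → Set
Separable G s t = Σ (Subset (n G)) λ S → (⟦ ∣ S ∣ ⟧ ≤ℚ s) × ComponentsAtMost G S t

IsSeparator : (G : Graph) → Subset (n G) → Set
IsSeparator G S = Σ (Subset (n G)) λ A → Σ (Subset (n G)) λ B →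
    (∀ v → v ∈ A ⊎ v ∈ B ⊎ v ∈ S)
  × (∀ v → v ∈ A → v ∉ B)
  × (∀ v → v ∈ A → v ∉ S)
  × (∀ v → v ∈ B → v ∉ S)
  × (∀ a b → a ∈ A → b ∈ B → ¬ (adj G a b ≡ true))
  × (⟦ ∣ A ∣ ⟧ ≤ℚ ⟦ 2 * n G ⟧ *ℚ (1/ ⟦ 3 ⟧))
  × (⟦ ∣ B ∣ ⟧ ≤ℚ ⟦ 2 * n G ⟧ *ℚ (1/ ⟦ 3 ⟧))

-- H is a subgraph of G (up to relabelling): an injective vertex map
-- sending edges of H to edges of G
Subgraph : Graph → Graph → Set
Subgraph H G = Σ (Fin (n H) → Fin (n G)) λ f →
  Injective _≡_ _≡_ f × (∀ u v → adj H u v ≡ true → adj G (f u) (f v) ≡ true)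

sepBound : (k : ℕ) (s t : ℚ) → 0ℚ < s → 0ℚ < t → ℚ
sepBound k s t s>0 t>0 =
  (⟦ 4 * k * k ⟧ *ℚ (1/ s) {{>-nonZero s>0}}) *ℚ (1/ t) {{>-nonZero t>0}}

module Submission where

-- Separate recursively, starting from P = V(G). A set P with more than t vertices either induces a
-- subgraph without a separator of size at most |P|/s, which is the required H, or such a separator
-- splits it into A and B with |A|, |B| ≤ 2|P|/3, and we recurse into A and B. If H is never found,
-- the union of all separators used leaves components of at most t vertices. Every split is applied
-- to at least ⌊t⌋ + 1 vertices and is balanced, so the number k of splits satisfies
-- (k + 2)(⌊t⌋ + 1) ≤ 3n unless k = 0; as every separator has at most n/s vertices, the union has at
-- most 3n²/(st) ≤ 4n²/(st) vertices, and G would be (4n²/(st), t)-separable.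

open import Defs hiding (sym)
open import Data.Bool.Base using (true; false)
open import Data.Empty using (⊥-elim)
open import Data.Fin.Base using (Fin; zero; suc)
open import Data.Fin.Subset using (Subset; _∈_; _∉_; _⊆_; _∪_; ∁; ⊤; ⊥; ∣_∣)
import Data.Fin.Subset.Properties as Subset
open import Data.Nat.Base as ℕ using (ℕ)
import Data.Nat.Induction as ℕ
import Data.Nat.Properties as ℕ
open import Data.Product.Base using (Σ; Σ-syntax; ∃; _×_; _,_)
open import Data.Rational using (ℚ)
import Data.Rational.Base as ℚ
import Data.Rational.Properties as ℚ
open import Data.Sum.Base using (_⊎_; inj₁; inj₂; [_,_]; [_,_]′)
open import Function.Base using (_∘_)
open import Function.Bundles using (_⇔_; mk⇔; Equivalence)
open import Function.Definitions using (Injective)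
open import Relation.Binary.PropositionalEquality using (_≡_; _≢_; refl; sym; trans; cong; cong₂; subst; subst₂)
open import Relation.Nullary using (¬_; Dec; yes; no)

module NaturalsAsRationals where
  open import Data.Integer.Base as ℤ using (+_)
  import Data.Integer.Properties as ℤ
  open import Data.Nat.Base using (suc)
  import Data.Nat.DivMod as ℕ
  open import Data.Nat.Coprimality using (Coprime; 1-coprimeTo) renaming (sym to coprime-sym)
  open import Data.Rational.Base
    using (ℚ; mkℚ; 1ℚ; _≤_; _<_; _*_; 1/_; *≤*; NonZero; NonNegative; Positive; toℚᵘ)
  open import Data.Rational.Unnormalised.Base as ℚᵘ using (mkℚᵘ)
  import Data.Rational.Unnormalised.Properties as ℚᵘ

  ⟦⟧≡mkℚ : ∀ k → ⟦ k ⟧ ≡ mkℚ (+ k) 0 (coprime-sym (1-coprimeTo k))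
  ⟦⟧≡mkℚ k = ℚ.normalize-coprime (coprime-sym (1-coprimeTo k))

  ⟦⟧≤mkℚ⇔ : ∀ x p d .(c : Coprime p (suc d)) → ⟦ x ⟧ ≤ mkℚ (+ p) d c ⇔ x ℕ.* suc d ℕ.≤ p
  ⟦⟧≤mkℚ⇔ x p d c rewrite ⟦⟧≡mkℚ x = mk⇔
    (λ { (*≤* xd≤p) → ℤ.drop‿+≤+ (subst₂ ℤ._≤_ (sym (ℤ.pos-* x (suc d))) (ℤ.*-identityʳ (+ p)) xd≤p) })
    (λ xd≤p → *≤* (subst₂ ℤ._≤_ (ℤ.pos-* x (suc d)) (sym (ℤ.*-identityʳ (+ p))) (ℤ.+≤+ xd≤p)))

  ⟦⟧-nonNeg : ∀ k → NonNegative ⟦ k ⟧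
  ⟦⟧-nonNeg k = ℚ.normalize-nonNeg k 1

  ⟦⟧-mono-≤ : ∀ {a b} → a ℕ.≤ b → ⟦ a ⟧ ≤ ⟦ b ⟧
  ⟦⟧-mono-≤ {a} {b} a≤b = subst (⟦ a ⟧ ≤_) (sym (⟦⟧≡mkℚ b))
    (Equivalence.from (⟦⟧≤mkℚ⇔ a b 0 _) (subst (ℕ._≤ b) (sym (ℕ.*-identityʳ a)) a≤b))

  ⟦⟧-cancel-≤ : ∀ {a b} → ⟦ a ⟧ ≤ ⟦ b ⟧ → a ℕ.≤ b
  ⟦⟧-cancel-≤ {a} {b} ⟦a⟧≤⟦b⟧ = subst (ℕ._≤ b) (ℕ.*-identityʳ a)
    (Equivalence.to (⟦⟧≤mkℚ⇔ a b 0 _) (subst (⟦ a ⟧ ≤_) (⟦⟧≡mkℚ b) ⟦a⟧≤⟦b⟧))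

  ⟦⟧-homo-* : ∀ a b → ⟦ a ℕ.* b ⟧ ≡ ⟦ a ⟧ * ⟦ b ⟧
  ⟦⟧-homo-* a b = ℚ.toℚᵘ-injective (begin
    toℚᵘ ⟦ a ℕ.* b ⟧                  ≡⟨ cong toℚᵘ (⟦⟧≡mkℚ (a ℕ.* b)) ⟩
    mkℚᵘ (+ (a ℕ.* b)) 0              ≡⟨ cong (λ i → mkℚᵘ i 0) (ℤ.pos-* a b) ⟩
    mkℚᵘ (+ a) 0 ℚᵘ.* mkℚᵘ (+ b) 0    ≡⟨ sym (cong₂ ℚᵘ._*_ (cong toℚᵘ (⟦⟧≡mkℚ a)) (cong toℚᵘ (⟦⟧≡mkℚ b))) ⟩
    toℚᵘ ⟦ a ⟧ ℚᵘ.* toℚᵘ ⟦ b ⟧        ≈⟨ ℚᵘ.≃-sym (ℚ.toℚᵘ-homo-* ⟦ a ⟧ ⟦ b ⟧) ⟩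
    toℚᵘ (⟦ a ⟧ * ⟦ b ⟧)              ∎)
    where open ℚᵘ.≃-Reasoning

  record NatFloor (y : ℚ) : Set where
    field
      ⌊y⌋     : ℕ
      ⌊y⌋≤y   : ⟦ ⌊y⌋ ⟧ ≤ y
      greatest : ∀ {x} → ⟦ x ⟧ ≤ y → x ℕ.≤ ⌊y⌋

    <⟦⟧ : ∀ {x} → ⌊y⌋ ℕ.< x → y < ⟦ x ⟧
    <⟦⟧ ⌊y⌋<x = ℚ.≰⇒> (λ ⟦x⟧≤y → ℕ.<⇒≱ ⌊y⌋<x (greatest ⟦x⟧≤y))

  natFloor : ∀ y .{{_ : NonNegative y}} → NatFloor y
  natFloor (mkℚ (+ p) d c) = record
    { ⌊y⌋      = p ℕ./ suc d
    ; ⌊y⌋≤y    = Equivalence.from (⟦⟧≤mkℚ⇔ (p ℕ./ suc d) p d c) (ℕ.m/n*n≤m p (suc d))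
    ; greatest = λ {x} ⟦x⟧≤y → subst (ℕ._≤ p ℕ./ suc d) (ℕ.m*n/n≡m x (suc d))
                   (ℕ./-monoˡ-≤ (suc d) (Equivalence.to (⟦⟧≤mkℚ⇔ x p d c) ⟦x⟧≤y))
    }

  module _ (r : ℚ) .{{_ : Positive r}} where
    private instance
      r≢0 : NonZero r
      r≢0 = ℚ.pos⇒nonZero r
      r≥0 : NonNegative r
      r≥0 = ℚ.pos⇒nonNeg r
      1/r≥0 : NonNegative (1/ r)
      1/r≥0 = ℚ.pos⇒nonNeg (1/ r) {{ℚ.1/pos⇒pos r}}

    ≤*1/⇔*≤ : ∀ p q → p ≤ q * 1/ r ⇔ p * r ≤ q
    ≤*1/⇔*≤ p q = mk⇔
      (λ p≤q/r → subst (p * r ≤_) (cancel (ℚ.*-inverseˡ r)) (ℚ.*-monoʳ-≤-nonNeg r p≤q/r))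
      (λ pr≤q → subst (_≤ q * 1/ r) (cancel (ℚ.*-inverseʳ r)) (ℚ.*-monoʳ-≤-nonNeg (1/ r) pr≤q))
      where
      cancel : ∀ {x y z} → y * z ≡ 1ℚ → x * y * z ≡ x
      cancel {x} {y} {z} yz≡1 = trans (ℚ.*-assoc x y z) (trans (cong (x *_) yz≡1) (ℚ.*-identityʳ x))

  ≤⅔⇒3*≤2* : ∀ a c → ⟦ a ⟧ ≤ ⟦ 2 ℕ.* c ⟧ * 1/ ⟦ 3 ⟧ → 3 ℕ.* a ℕ.≤ 2 ℕ.* c
  ≤⅔⇒3*≤2* a c a≤⅔c = subst (ℕ._≤ 2 ℕ.* c) (ℕ.*-comm a 3) (⟦⟧-cancel-≤
    (subst (_≤ ⟦ 2 ℕ.* c ⟧) (sym (⟦⟧-homo-* a 3)) (Equivalence.to (≤*1/⇔*≤ ⟦ 3 ⟧ _ _) a≤⅔c)))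

open NaturalsAsRationals

module Subsets where
  open import Data.Nat.Base using (suc; _+_; _≤_; _∸_; s≤s; z≤n)
  import Data.Fin.Properties as Fin
  open import Data.Vec.Base using (_∷_; []; here; there)

  private variable
    m : ℕ

  element : (P : Subset m) → Fin ∣ P ∣ → Fin m
  element (true  ∷ P) zero    = zero
  element (true  ∷ P) (suc i) = suc (element P i)
  element (false ∷ P) i       = suc (element P i)

  element-injective : (P : Subset m) → Injective _≡_ _≡_ (element P)
  element-injective (true  ∷ P) {zero}  {zero}  _  = refl
  element-injective (true  ∷ P) {suc i} {suc j} eq = cong suc (element-injective P (Fin.suc-injective eq))
  element-injective (false ∷ P)                 eq = element-injective P (Fin.suc-injective eq)

  element-∈ : (P : Subset m) (i : Fin ∣ P ∣) → element P i ∈ P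
  element-∈ (true  ∷ P) zero    = here
  element-∈ (true  ∷ P) (suc i) = there (element-∈ P i)
  element-∈ (false ∷ P) i       = there (element-∈ P i)

  element-surjective : (P : Subset m) {v : Fin m} → v ∈ P → ∃ λ i → element P i ≡ v
  element-surjective (true  ∷ P) here       = zero , refl
  element-surjective (true  ∷ P) (there v∈P) with i , refl ← element-surjective P v∈P = suc i , refl
  element-surjective (false ∷ P) (there v∈P) with i , refl ← element-surjective P v∈P = i , refl

  image : (P : Subset m) → Subset ∣ P ∣ → Subset m
  image []          X       = []
  image (true  ∷ P) (x ∷ X) = x ∷ image P X
  image (false ∷ P) X       = false ∷ image P X

  ∣image∣≡∣X∣ : (P : Subset m) (X : Subset ∣ P ∣) → ∣ image P X ∣ ≡ ∣ X ∣
  ∣image∣≡∣X∣ []          []          = refl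
  ∣image∣≡∣X∣ (true  ∷ P) (true  ∷ X) = cong suc (∣image∣≡∣X∣ P X)
  ∣image∣≡∣X∣ (true  ∷ P) (false ∷ X) = ∣image∣≡∣X∣ P X
  ∣image∣≡∣X∣ (false ∷ P) X           = ∣image∣≡∣X∣ P X

  image-∈⁺ : (P : Subset m) (X : Subset ∣ P ∣) {i : Fin ∣ P ∣} → i ∈ X → element P i ∈ image P X
  image-∈⁺ (true  ∷ P) (x ∷ X) here        = here
  image-∈⁺ (true  ∷ P) (x ∷ X) (there i∈X) = there (image-∈⁺ P X i∈X)
  image-∈⁺ (false ∷ P) X       i∈X         = there (image-∈⁺ P X i∈X)

  image-∈⁻ : (P : Subset m) (X : Subset ∣ P ∣) {v : Fin m} → v ∈ image P X → ∃ λ i → i ∈ X × element P i ≡ v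
  image-∈⁻ (true  ∷ P) (x ∷ X) here = zero , here , refl
  image-∈⁻ (true  ∷ P) (x ∷ X) (there v∈X) with i , i∈X , refl ← image-∈⁻ P X v∈X = suc i , there i∈X , refl
  image-∈⁻ (false ∷ P) X       (there v∈X) with i , i∈X , refl ← image-∈⁻ P X v∈X = i , i∈X , refl

  image⊆ : (P : Subset m) (X : Subset ∣ P ∣) → image P X ⊆ P
  image⊆ P X v∈X with i , _ , refl ← image-∈⁻ P X v∈X = element-∈ P i

  ∣p∪q∣≤∣p∣+∣q∣ : (p q : Subset m) → ∣ p ∪ q ∣ ≤ ∣ p ∣ + ∣ q ∣
  ∣p∪q∣≤∣p∣+∣q∣ []          []          = z≤n
  ∣p∪q∣≤∣p∣+∣q∣ (true  ∷ p) (x ∷ q)     =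
    s≤s (ℕ.≤-trans (∣p∪q∣≤∣p∣+∣q∣ p q) (ℕ.+-monoʳ-≤ ∣ p ∣ (Subset.∣p∣≤∣x∷p∣ x q)))
  ∣p∪q∣≤∣p∣+∣q∣ (false ∷ p) (true  ∷ q) =
    subst (suc ∣ p ∪ q ∣ ≤_) (sym (ℕ.+-suc ∣ p ∣ ∣ q ∣)) (s≤s (∣p∪q∣≤∣p∣+∣q∣ p q))
  ∣p∪q∣≤∣p∣+∣q∣ (false ∷ p) (false ∷ q) = ∣p∪q∣≤∣p∣+∣q∣ p q

  discombinet⇒∣p∣+∣q∣≤n : (p q : Subset m) → (∀ {x} → x ∈ p → x ∉ q) → ∣ p ∣ + ∣ q ∣ ≤ m
  discombinet⇒∣p∣+∣q∣≤n {m} p q discombinet = begin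
    ∣ p ∣ + ∣ q ∣        ≤⟨ ℕ.+-monoʳ-≤ ∣ p ∣ (Subset.p⊆q⇒∣p∣≤∣q∣ q⊆∁p) ⟩
    ∣ p ∣ + ∣ ∁ p ∣      ≡⟨ cong (∣ p ∣ +_) (Subset.∣∁p∣≡n∸∣p∣ p) ⟩
    ∣ p ∣ + (m ∸ ∣ p ∣)  ≡⟨ ℕ.m+[n∸m]≡n (Subset.∣p∣≤n p) ⟩
    m                    ∎
    where
    open ℕ.≤-Reasoning
    q⊆∁p : q ⊆ ∁ p
    q⊆∁p x∈q = Subset.x∉p⇒x∈∁p (λ x∈p → discombinet x∈p x∈q)

open Subsets

module InducedSubgraphs where
  import Data.Bool.Properties as Bool
  open import Data.Fin.Properties using (all?)
  open import Data.Nat.Base using (_+_; _*_; _≤_)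
  open import Data.Rational.Base using (1/_) renaming (_≤_ to _≤ℚ_; _*_ to _*ℚ_)
  open import Relation.Nullary.Decidable using (_×-dec_; _⊎-dec_; _→-dec_; ¬?)

  induced : (G : Graph) → Subset (n G) → Graph
  induced G P = record
    { n      = ∣ P ∣
    ; adj    = λ i j → adj G (element P i) (element P j)
    ; sym    = λ i j → Graph.sym G (element P i) (element P j)
    ; irrefl = λ i → irrefl G (element P i)
    }

  induced-subgraph : (G : Graph) (P : Subset (n G)) → Subgraph (induced G P) G
  induced-subgraph G P = element P , element-injective P , λ _ _ uv∈E → uv∈E

  SmallSeparator : Graph → ℚ → Set
  SmallSeparator H q = Σ[ S ∈ Subset (n H) ] IsSeparator H S × ⟦ ∣ S ∣ ⟧ ≤ℚ q *ℚ ⟦ n H ⟧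

  isSeparator? : (H : Graph) (S : Subset (n H)) → Dec (IsSeparator H S)
  isSeparator? H S = Subset.anySubset? λ A → Subset.anySubset? λ B →
        all? (λ v → (v Subset.∈? A) ⊎-dec (v Subset.∈? B) ⊎-dec (v Subset.∈? S))
    ×-dec all? (λ v → (v Subset.∈? A) →-dec ¬? (v Subset.∈? B))
    ×-dec all? (λ v → (v Subset.∈? A) →-dec ¬? (v Subset.∈? S))
    ×-dec all? (λ v → (v Subset.∈? B) →-dec ¬? (v Subset.∈? S))
    ×-dec all? (λ a → all? λ b → (a Subset.∈? A) →-dec (b Subset.∈? B) →-dec ¬? (adj H a b Bool.≟ true))
    ×-dec (⟦ ∣ A ∣ ⟧ ℚ.≤? ⟦ 2 * n H ⟧ *ℚ 1/ ⟦ 3 ⟧)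
    ×-dec (⟦ ∣ B ∣ ⟧ ℚ.≤? ⟦ 2 * n H ⟧ *ℚ 1/ ⟦ 3 ⟧)

  smallSeparator? : (H : Graph) (q : ℚ) → Dec (SmallSeparator H q)
  smallSeparator? H q = Subset.anySubset? λ S → isSeparator? H S ×-dec (⟦ ∣ S ∣ ⟧ ℚ.≤? q *ℚ ⟦ n H ⟧)

  record Separation (G : Graph) (P : Subset (n G)) : Set where
    field
      A B S       : Subset (n G)
      A⊆P         : A ⊆ P
      B⊆P         : B ⊆ P
      cover       : ∀ {v} → v ∈ P → v ∉ S → v ∈ A ⊎ v ∈ B
      no-edge     : ∀ {a b} → a ∈ A → b ∈ B → adj G a b ≢ true
      ∣A∣+∣B∣≤∣P∣ : ∣ A ∣ + ∣ B ∣ ≤ ∣ P ∣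
      3∣A∣≤2∣P∣   : 3 * ∣ A ∣ ≤ 2 * ∣ P ∣
      3∣B∣≤2∣P∣   : 3 * ∣ B ∣ ≤ 2 * ∣ P ∣

  separation : (G : Graph) (P : Subset (n G)) (S′ : Subset ∣ P ∣) →
               IsSeparator (induced G P) S′ → Separation G P
  separation G P S′ (A′ , B′ , cover′ , discombinet′ , _ , _ , no-edge′ , ∣A′∣≤⅔∣P∣ , ∣B′∣≤⅔∣P∣) = record
    { A           = image P A′
    ; B           = image P B′
    ; S           = image P S′
    ; A⊆P         = image⊆ P A′
    ; B⊆P         = image⊆ P B′
    ; cover       = cover
    ; no-edge     = no-edge
    ; ∣A∣+∣B∣≤∣P∣ = subst₂ (λ a b → a + b ≤ ∣ P ∣) (sym (∣image∣≡∣X∣ P A′)) (sym (∣image∣≡∣X∣ P B′))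
                      (discombinet⇒∣p∣+∣q∣≤n A′ B′ (discombinet′ _))
    ; 3∣A∣≤2∣P∣   = subst (λ a → 3 * a ≤ 2 * ∣ P ∣) (sym (∣image∣≡∣X∣ P A′)) (≤⅔⇒3*≤2* ∣ A′ ∣ ∣ P ∣ ∣A′∣≤⅔∣P∣)
    ; 3∣B∣≤2∣P∣   = subst (λ b → 3 * b ≤ 2 * ∣ P ∣) (sym (∣image∣≡∣X∣ P B′)) (≤⅔⇒3*≤2* ∣ B′ ∣ ∣ P ∣ ∣B′∣≤⅔∣P∣)
    }
    where
    cover : ∀ {v} → v ∈ P → v ∉ image P S′ → v ∈ image P A′ ⊎ v ∈ image P B′
    cover v∈P v∉S with i , refl ← element-surjective P v∈P with cover′ i
    ... | inj₁ i∈A′        = inj₁ (image-∈⁺ P A′ i∈A′)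
    ... | inj₂ (inj₁ i∈B′) = inj₂ (image-∈⁺ P B′ i∈B′)
    ... | inj₂ (inj₂ i∈S′) = ⊥-elim (v∉S (image-∈⁺ P S′ i∈S′))
    no-edge : ∀ {a b} → a ∈ image P A′ → b ∈ image P B′ → adj G a b ≢ true
    no-edge a∈A b∈B with i , i∈A′ , refl ← image-∈⁻ P A′ a∈A | j , j∈B′ , refl ← image-∈⁻ P B′ b∈B =
      no-edge′ i j i∈A′ j∈B′

open InducedSubgraphs

module SplitCounting where
  open import Data.Nat.Base using (suc; _+_; _*_; _≤_; _<_; z≤n; >-nonZero)
  open import Data.Nat.Tactic.RingSolver using (solve-∀)

  -- Invariant for k balanced splits performed recursively inside a set of c vertices, each on a set
  -- of at least T vertices; the slack 2T absorbs a split one of whose sides is not split again.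
  data SplitBound (T : ℕ) : (k c : ℕ) → Set where
    unsplit : ∀ {c} → SplitBound T 0 c
    bounded : ∀ {k c} → (k + 2) * T ≤ 3 * c → SplitBound T k c

  splitBound⇒*≤ : ∀ {T k c} → SplitBound T k c → k * T ≤ 3 * c
  splitBound⇒*≤ unsplit = z≤n
  splitBound⇒*≤ {T} {k} (bounded k+2≤3c) = ℕ.≤-trans (ℕ.*-monoˡ-≤ T (ℕ.m≤m+n k 2)) k+2≤3c

  splitBound-node : ∀ {T c a b ka kb} → T ≤ c → a + b ≤ c → 3 * a ≤ 2 * c → 3 * b ≤ 2 * c →
                    SplitBound T ka a → SplitBound T kb b → SplitBound T (suc (ka + kb)) c
  splitBound-node T≤c _ _ _ unsplit unsplit = bounded (ℕ.*-monoʳ-≤ 3 T≤c)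
  splitBound-node {T} {c} {ka = ka} T≤c _ 3a≤2c _ (bounded ka+2≤3a) unsplit = bounded (begin
    (suc (ka + 0) + 2) * T  ≡⟨ cong (λ k → (suc k + 2) * T) (ℕ.+-identityʳ ka) ⟩
    T + (ka + 2) * T        ≤⟨ ℕ.+-mono-≤ T≤c (ℕ.≤-trans ka+2≤3a 3a≤2c) ⟩
    3 * c                   ∎)
    where open ℕ.≤-Reasoning
  splitBound-node T≤c _ _ 3b≤2c unsplit (bounded kb+2≤3b) =
    bounded (ℕ.+-mono-≤ T≤c (ℕ.≤-trans kb+2≤3b 3b≤2c))
  splitBound-node {T} {c} {a} {b} {ka} {kb} _ a+b≤c _ _ (bounded ka+2≤3a) (bounded kb+2≤3b) = bounded (begin
    (suc (ka + kb) + 2) * T          ≤⟨ ℕ.m≤m+n _ T ⟩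
    (suc (ka + kb) + 2) * T + T      ≡⟨ regroup ka kb T ⟩
    (ka + 2) * T + (kb + 2) * T      ≤⟨ ℕ.+-mono-≤ ka+2≤3a kb+2≤3b ⟩
    3 * a + 3 * b                    ≡⟨ ℕ.*-distribˡ-+ 3 a b ⟨
    3 * (a + b)                      ≤⟨ ℕ.*-monoʳ-≤ 3 a+b≤c ⟩
    3 * c                            ∎)
    where
    open ℕ.≤-Reasoning
    regroup : ∀ ka kb T → (suc (ka + kb) + 2) * T + T ≡ (ka + 2) * T + (kb + 2) * T
    regroup = solve-∀

  3*≤2*⇒< : ∀ {a c} → 3 * a ≤ 2 * c → 0 < c → a < c
  3*≤2*⇒< {a} {c} 3a≤2c 0<c =
    ℕ.*-cancelˡ-< 3 a c (ℕ.≤-<-trans 3a≤2c (ℕ.*-monoˡ-< c {{>-nonZero 0<c}} (ℕ.n<1+n 2)))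

open SplitCounting

module Pieces (G : Graph) (f : ℕ) where
  open import Data.Nat.Base using (_≤_)
  open import Data.Rational.Base using () renaming (_≤_ to _≤ℚ_)
  open Separation using (A; B; S; A⊆P; B⊆P; cover; no-edge)

  ClosedIn : (P S Q : Subset (n G)) → Set
  ClosedIn P S Q = ∀ {u w} → u ∈ Q → w ∈ P → w ∉ S → adj G u w ≡ true → w ∈ Q

  -- A piece of v stands in for the component of v in G[P] − S: being closed, it contains that
  -- component (closed-reach), and it is much easier to build than the component itself.
  Piece : (P S : Subset (n G)) → Fin (n G) → Set
  Piece P S v = Σ[ Q ∈ Subset (n G) ] v ∈ Q × Q ⊆ P × ∣ Q ∣ ≤ f × ClosedIn P S Q

  SmallPieces : (P S : Subset (n G)) → Set
  SmallPieces P S = ∀ {v} → v ∈ P → v ∉ S → Piece P S v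

  smallPieces-small : ∀ {P S} → ∣ P ∣ ≤ f → SmallPieces P S
  smallPieces-small {P} ∣P∣≤f v∈P _ = P , v∈P , (λ u∈P → u∈P) , ∣P∣≤f , λ _ w∈P _ _ → w∈P

  piece-lift : ∀ {P X S SX v} → X ⊆ P → SX ⊆ S → ClosedIn P S X → Piece X SX v → Piece P S v
  piece-lift X⊆P SX⊆S X-closed (Q , v∈Q , Q⊆X , ∣Q∣≤f , Q-closed) =
    Q , v∈Q , X⊆P ∘ Q⊆X , ∣Q∣≤f ,
    λ u∈Q w∈P w∉S uw → Q-closed u∈Q (X-closed (Q⊆X u∈Q) w∈P w∉S uw) (w∉S ∘ SX⊆S) uw

  module _ {P} (σ : Separation G P) {S*} (S⊆S* : S σ ⊆ S*) where

    A-closed : ClosedIn P S* (A σ)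
    A-closed u∈A w∈P w∉S* uw with cover σ w∈P (w∉S* ∘ S⊆S*)
    ... | inj₁ w∈A = w∈A
    ... | inj₂ w∈B = ⊥-elim (no-edge σ u∈A w∈B uw)

    B-closed : ClosedIn P S* (B σ)
    B-closed {u} {w} u∈B w∈P w∉S* uw with cover σ w∈P (w∉S* ∘ S⊆S*)
    ... | inj₁ w∈A = ⊥-elim (no-edge σ w∈A u∈B (trans (Graph.sym G w u) uw))
    ... | inj₂ w∈B = w∈B

  smallPieces-split : ∀ {P SA SB} (σ : Separation G P) →
    SmallPieces (A σ) SA → SmallPieces (B σ) SB → SmallPieces P (S σ ∪ (SA ∪ SB))
  smallPieces-split {P} {SA} {SB} σ piecesA piecesB v∈P v∉S* =
    [ (λ v∈A → piece-lift (A⊆P σ) SA⊆S* (A-closed σ S⊆S*) (piecesA v∈A (v∉S* ∘ SA⊆S*)))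
    , (λ v∈B → piece-lift (B⊆P σ) SB⊆S* (B-closed σ S⊆S*) (piecesB v∈B (v∉S* ∘ SB⊆S*)))
    ] (cover σ v∈P (v∉S* ∘ S⊆S*))
    where
    S* : Subset (n G)
    S* = S σ ∪ (SA ∪ SB)
    S⊆S* : S σ ⊆ S*
    S⊆S* = Subset.p⊆p∪q (SA ∪ SB)
    SA⊆S* : SA ⊆ S*
    SA⊆S* = Subset.q⊆p∪q (S σ) (SA ∪ SB) ∘ Subset.p⊆p∪q SB
    SB⊆S* : SB ⊆ S*
    SB⊆S* = Subset.q⊆p∪q (S σ) (SA ∪ SB) ∘ Subset.q⊆p∪q SA SB

  closed-reach : ∀ {S Q v u} → ClosedIn ⊤ S Q → v ∈ Q → Reach G S v u → u ∈ Q
  closed-reach Q-closed v∈Q (here _)        = v∈Q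
  closed-reach Q-closed v∈Q (step r uw w∉S) = Q-closed (closed-reach Q-closed v∈Q r) Subset.∈⊤ w∉S uw

  smallPieces⇒componentsAtMost : ∀ {S t} → SmallPieces ⊤ S → ⟦ f ⟧ ≤ℚ t → ComponentsAtMost G S t
  smallPieces⇒componentsAtMost pieces f≤t v v∉S C C⇔reach
    with Q , v∈Q , _ , ∣Q∣≤f , Q-closed ← pieces Subset.∈⊤ v∉S =
    ℚ.≤-trans (⟦⟧-mono-≤ (ℕ.≤-trans ∣C∣≤∣Q∣ ∣Q∣≤f)) f≤t
    where
    ∣C∣≤∣Q∣ : ∣ C ∣ ≤ ∣ Q ∣
    ∣C∣≤∣Q∣ = Subset.p⊆q⇒∣p∣≤∣q∣ (closed-reach Q-closed v∈Q ∘ Equivalence.to (C⇔reach _))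

module RecursiveSeparation
  (G : Graph) (f : ℕ) (q : ℚ) (L : ℕ)
  (small⇒≤L : ∀ {c x} → c ℕ.≤ n G → ⟦ x ⟧ ℚ.≤ q ℚ.* ⟦ c ⟧ → x ℕ.≤ L)
  where
  open import Data.Nat.Base using (suc; _+_; _*_; _≤_; _<_)
  open import Induction.WellFounded using (Acc; acc)
  open Pieces G f
  open Separation using (A; B; S; ∣A∣+∣B∣≤∣P∣; 3∣A∣≤2∣P∣; 3∣B∣≤2∣P∣)

  record Decomposition (P : Subset (n G)) : Set where
    field
      separator   : Subset (n G)
      splits      : ℕ
      ∣separator∣ : ∣ separator ∣ ≤ splits * L
      splitBound  : SplitBound (suc f) splits ∣ P ∣
      pieces      : SmallPieces P separator

  DenseSet : Set
  DenseSet = Σ[ P ∈ Subset (n G) ] f < ∣ P ∣ × ¬ SmallSeparator (induced G P) q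

  decomposition-small : ∀ {P} → ∣ P ∣ ≤ f → Decomposition P
  decomposition-small ∣P∣≤f = record
    { separator   = ⊥
    ; splits      = 0
    ; ∣separator∣ = ℕ.≤-reflexive (Subset.∣⊥∣≡0 (n G))
    ; splitBound  = unsplit
    ; pieces      = smallPieces-small ∣P∣≤f
    }

  decomposition-split : ∀ {P} → f < ∣ P ∣ → (σ : Separation G P) → ∣ S σ ∣ ≤ L →
    Decomposition (A σ) → Decomposition (B σ) → Decomposition P
  decomposition-split {P} f<∣P∣ σ ∣S∣≤L dA dB = record
    { separator   = S σ ∪ (SA ∪ SB)
    ; splits      = suc (kA + kB)
    ; ∣separator∣ = begin
        ∣ S σ ∪ (SA ∪ SB) ∣          ≤⟨ ∣p∪q∣≤∣p∣+∣q∣ (S σ) (SA ∪ SB) ⟩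
        ∣ S σ ∣ + ∣ SA ∪ SB ∣        ≤⟨ ℕ.+-monoʳ-≤ ∣ S σ ∣ (∣p∪q∣≤∣p∣+∣q∣ SA SB) ⟩
        ∣ S σ ∣ + (∣ SA ∣ + ∣ SB ∣)  ≤⟨ ℕ.+-mono-≤ ∣S∣≤L (ℕ.+-mono-≤ DA.∣separator∣ DB.∣separator∣) ⟩
        L + (kA * L + kB * L)        ≡⟨ cong (L +_) (ℕ.*-distribʳ-+ L kA kB) ⟨
        suc (kA + kB) * L            ∎
    ; splitBound  = splitBound-node f<∣P∣ (∣A∣+∣B∣≤∣P∣ σ) (3∣A∣≤2∣P∣ σ) (3∣B∣≤2∣P∣ σ)
                      DA.splitBound DB.splitBound
    ; pieces      = smallPieces-split σ DA.pieces DB.pieces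
    }
    where
    module DA = Decomposition dA
    module DB = Decomposition dB
    open DA using () renaming (separator to SA; splits to kA)
    open DB using () renaming (separator to SB; splits to kB)
    open ℕ.≤-Reasoning

  combine : ∀ {P} → f < ∣ P ∣ → (σ : Separation G P) → ∣ S σ ∣ ≤ L →
    DenseSet ⊎ Decomposition (A σ) → DenseSet ⊎ Decomposition (B σ) → DenseSet ⊎ Decomposition P
  combine _      _ _     (inj₁ dense) _            = inj₁ dense
  combine _      _ _     (inj₂ _)     (inj₁ dense) = inj₁ dense
  combine f<∣P∣ σ ∣S∣≤L (inj₂ dA)    (inj₂ dB)    = inj₂ (decomposition-split f<∣P∣ σ ∣S∣≤L dA dB)

  decompose : (P : Subset (n G)) → Acc _<_ ∣ P ∣ → DenseSet ⊎ Decomposition P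
  decompose P (acc smaller) with ∣ P ∣ ℕ.≤? f
  ... | yes ∣P∣≤f = inj₂ (decomposition-small ∣P∣≤f)
  ... | no ∣P∣≰f = split-or-stop (smallSeparator? (induced G P) q)
    where
    f<∣P∣ : f < ∣ P ∣
    f<∣P∣ = ℕ.≰⇒> ∣P∣≰f
    0<∣P∣ : 0 < ∣ P ∣
    0<∣P∣ = ℕ.≤-<-trans ℕ.z≤n f<∣P∣
    split-or-stop : Dec (SmallSeparator (induced G P) q) → DenseSet ⊎ Decomposition P
    split-or-stop (no dense) = inj₁ (P , f<∣P∣ , dense)
    split-or-stop (yes (S′ , S′-separates , ∣S′∣≤q∣P∣)) =
      combine f<∣P∣ σ ∣S∣≤L
        (decompose (A σ) (smaller (3*≤2*⇒< (3∣A∣≤2∣P∣ σ) 0<∣P∣)))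
        (decompose (B σ) (smaller (3*≤2*⇒< (3∣B∣≤2∣P∣ σ) 0<∣P∣)))
      where
      σ : Separation G P
      σ = separation G P S′ S′-separates
      ∣S∣≤L : ∣ S σ ∣ ≤ L
      ∣S∣≤L = subst (_≤ L) (sym (∣image∣≡∣X∣ P S′)) (small⇒≤L (Subset.∣p∣≤n P) ∣S′∣≤q∣P∣)

open import Data.Rational using (0ℚ; _<_; _≤_; _*_; 1/_; >-nonZero; NonNegative; Positive; positive)
open import Data.Rational.Solver using (module +-*-Solver)

k*L≤sepBound : (s t : ℚ) (s>0 : 0ℚ < s) (t>0 : 0ℚ < t) (m k T L : ℕ.ℕ) →
  k ℕ.* T ℕ.≤ 3 ℕ.* m → t ≤ ⟦ T ⟧ → ⟦ L ⟧ ≤ (1/ s) {{>-nonZero s>0}} * ⟦ m ⟧ →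
  ⟦ k ℕ.* L ⟧ ≤ sepBound m s t s>0 t>0
k*L≤sepBound s t s>0 t>0 m k T L kT≤3m t≤⟦T⟧ ⟦L⟧≤m/s = begin
  ⟦ k ℕ.* L ⟧                     ≡⟨ ⟦⟧-homo-* k L ⟩
  ⟦ k ⟧ * ⟦ L ⟧                   ≤⟨ ℚ.*-monoˡ-≤-nonNeg ⟦ k ⟧ {{⟦⟧-nonNeg k}} ⟦L⟧≤m/s ⟩
  ⟦ k ⟧ * (1/s * ⟦ m ⟧)           ≤⟨ ℚ.*-monoʳ-≤-nonNeg (1/s * ⟦ m ⟧) {{m/s≥0}} ⟦k⟧≤4m/t ⟩
  ⟦ 4 ℕ.* m ⟧ * 1/t * (1/s * ⟦ m ⟧) ≡⟨ rearrange ⟦ 4 ℕ.* m ⟧ ⟦ m ⟧ 1/s 1/t ⟩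
  ⟦ 4 ℕ.* m ⟧ * ⟦ m ⟧ * 1/s * 1/t   ≡⟨ cong (λ x → x * 1/s * 1/t) (⟦⟧-homo-* (4 ℕ.* m) m) ⟨
  sepBound m s t s>0 t>0          ∎
  where
  open ℚ.≤-Reasoning
  instance
    s-pos : Positive s
    s-pos = positive s>0
    t-pos : Positive t
    t-pos = positive t>0
  1/s : ℚ
  1/s = (1/ s) {{>-nonZero s>0}}
  1/t : ℚ
  1/t = (1/ t) {{>-nonZero t>0}}
  m/s≥0 : NonNegative (1/s * ⟦ m ⟧)
  m/s≥0 = ℚ.nonNeg*nonNeg⇒nonNeg 1/s {{ℚ.pos⇒nonNeg 1/s {{ℚ.1/pos⇒pos s}}}} ⟦ m ⟧ {{⟦⟧-nonNeg m}}
  rearrange : ∀ a b x y → a * y * (x * b) ≡ a * b * x * y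
  rearrange = solve 4 (λ a b x y → (a :* y) :* (x :* b) := a :* b :* x :* y) refl
    where open +-*-Solver using (solve; _:=_; _:*_)
  ⟦k⟧≤4m/t : ⟦ k ⟧ ≤ ⟦ 4 ℕ.* m ⟧ * 1/t
  ⟦k⟧≤4m/t = Equivalence.from (≤*1/⇔*≤ t ⟦ k ⟧ ⟦ 4 ℕ.* m ⟧) (begin
    ⟦ k ⟧ * t        ≤⟨ ℚ.*-monoˡ-≤-nonNeg ⟦ k ⟧ {{⟦⟧-nonNeg k}} t≤⟦T⟧ ⟩
    ⟦ k ⟧ * ⟦ T ⟧    ≡⟨ ⟦⟧-homo-* k T ⟨
    ⟦ k ℕ.* T ⟧      ≤⟨ ⟦⟧-mono-≤ (ℕ.≤-trans kT≤3m (ℕ.*-monoˡ-≤ m (ℕ.n≤1+n 3))) ⟩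
    ⟦ 4 ℕ.* m ⟧      ∎)

lemma4p6 : (G : Graph) (s t : ℚ) (s>0 : 0ℚ < s) (t>0 : 0ℚ < t) →
    ¬ Separable G (sepBound (n G) s t s>0 t>0) t →
    Σ Graph λ H → Subgraph H G × (t ≤ ⟦ n H ⟧) ×
      (∀ (S : Subset (n H)) → IsSeparator H S →
        ¬ (⟦ ∣ S ∣ ⟧ ≤ (1/ s) {{>-nonZero s>0}} * ⟦ n H ⟧))
lemma4p6 G s t s>0 t>0 not-separable =
  [ (λ (P , ⌊t⌋<∣P∣ , dense) → induced G P , induced-subgraph G P , ℚ.<⇒≤ (⌊t⌋.<⟦⟧ ⌊t⌋<∣P∣) ,
                                λ S separates small → dense (S , separates , small))
  , (λ decomposition → ⊥-elim (not-separable (separable decomposition)))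
  ]′ (decompose ⊤ (ℕ.<-wellFounded _))
  where
  instance
    s-pos : Positive s
    s-pos = positive s>0
    t-pos : Positive t
    t-pos = positive t>0
  q : ℚ
  q = (1/ s) {{>-nonZero s>0}}
  q≥0 : NonNegative q
  q≥0 = ℚ.pos⇒nonNeg q {{ℚ.1/pos⇒pos s}}
  module ⌊t⌋ = NatFloor (natFloor t {{ℚ.pos⇒nonNeg t}})
  module ⌊qn⌋ =
    NatFloor (natFloor (q * ⟦ n G ⟧) {{ℚ.nonNeg*nonNeg⇒nonNeg q {{q≥0}} ⟦ n G ⟧ {{⟦⟧-nonNeg (n G)}}}})
  open Pieces G ⌊t⌋.⌊y⌋
  open RecursiveSeparation G ⌊t⌋.⌊y⌋ q ⌊qn⌋.⌊y⌋
    (λ c≤n ⟦x⟧≤qc → ⌊qn⌋.greatest (ℚ.≤-trans ⟦x⟧≤qc (ℚ.*-monoˡ-≤-nonNeg q {{q≥0}} (⟦⟧-mono-≤ c≤n))))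

  separable : Decomposition ⊤ → Separable G (sepBound (n G) s t s>0 t>0) t
  separable d = separator , ℚ.≤-trans (⟦⟧-mono-≤ ∣separator∣) ∣S∣≤sepBound
              , smallPieces⇒componentsAtMost pieces ⌊t⌋.⌊y⌋≤y
    where
    open Decomposition d
    few-splits : splits ℕ.* ℕ.suc ⌊t⌋.⌊y⌋ ℕ.≤ 3 ℕ.* n G
    few-splits = subst (λ c → splits ℕ.* ℕ.suc ⌊t⌋.⌊y⌋ ℕ.≤ 3 ℕ.* c) (Subset.∣⊤∣≡n (n G))
                   (splitBound⇒*≤ splitBound)
    ∣S∣≤sepBound : ⟦ splits ℕ.* ⌊qn⌋.⌊y⌋ ⟧ ≤ sepBound (n G) s t s>0 t>0
    ∣S∣≤sepBound = k*L≤sepBound s t s>0 t>0 (n G) splits (ℕ.suc ⌊t⌋.⌊y⌋) ⌊qn⌋.⌊y⌋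
                     few-splits (ℚ.<⇒≤ (⌊t⌋.<⟦⟧ ℕ.≤-refl)) ⌊qn⌋.⌊y⌋≤y
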